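{- Let $G$ be a graph with a special branching point $x$ having a leg attached whose leaf (degree-$1$ vertex) is $y$. If $G$ has a detection pair $(W,L)$ with $x\in L$, then $(W,(L\setminus\{x\})\cup\{y\})$ is also a detection pair of $G$.
   Context: All graphs are finite, simple and undirected, and $d(u,v)$ denotes the distance. A vertex $w$ dominates the vertices of $N[w]$; a vertex $l$ separates $u,v$ if $d(u,l)\neq d(v,l)$. Given $W,L\subseteq V(G)$, a vertex $u$ is distinguished by $(W,L)$ if either $u$ is dominated by a vertex of $W$, or for every other vertex $v$, either $v$ is dominated by a vertex of $W$ or some vertex of $L$ separates $u$ and $v$; $(W,L)$ is a detection pair if every vertex is distinguished. A vertex $v$ of degree at least $3$ is a special branching point if there is a path from $v$ to a vertex of degree $1$ whose inner vertices all have degree $2$; for each such path $P$, $P-v$ is a leg attached to $v$, and its degree-$1$ endpoint is the leaf of the leg. -}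

module Defs where

open import Data.Nat using (ℕ; zero; suc; _<_; _≥_)
open import Data.Fin using (Fin; zero; suc; inject₁; fromℕ)
open import Data.Bool using (Bool; true; false; T)
open import Data.Vec using (tabulate)
open import Data.Fin.Subset using (Subset; _∈_; ∣_∣; _-_; _∪_; ⁅_⁆)
open import Data.Product using (Σ; ∃; _×_; _,_)
open import Data.Sum using (_⊎_)
open import Relation.Nullary using (¬_)
open import Relation.Binary.PropositionalEquality using (_≡_; _≢_)
open import Function.Bundles using (_⇔_)
open import Function.Definitions using (Injective)

record Graph : Set where
  field
    n     : ℕ
    adj   : Fin n → Fin n → Bool
    sym   : ∀ u v → adj u v ≡ adj v u
    irrefl : ∀ v → adj v v ≡ false

module _ (G : Graph) where
  open Graph G

  Vertex : Set
  Vertex = Fin n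

  Adj : Vertex → Vertex → Set
  Adj u v = T (adj u v)

  N : Vertex → Subset n
  N v = tabulate (λ w → adj v w)

  deg : Vertex → ℕ
  deg v = ∣ N v ∣

  data Walk : Vertex → Vertex → ℕ → Set where
    here : ∀ {u} → Walk u u zero
    step : ∀ {u w v k} → Adj u w → Walk w v k → Walk u v (suc k)

  -- d(u,v) = k  (an infinite distance, for disconnected u,v, satisfies IsDist for no k)
  IsDist : Vertex → Vertex → ℕ → Set
  IsDist u v k = Walk u v k × (∀ m → m < k → ¬ Walk u v m)

  -- d(u,l) = d(v,l), with the value ∞ allowed
  SameDist : Vertex → Vertex → Vertex → Set
  SameDist l u v = ∀ k → IsDist u l k ⇔ IsDist v l k

  Separates : Vertex → Vertex → Vertex → Set
  Separates l u v = ¬ SameDist l u v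

  Dominated : Subset n → Vertex → Set
  Dominated W u = ∃ λ w → w ∈ W × (w ≡ u ⊎ Adj w u)

  Distinguished : Subset n → Subset n → Vertex → Set
  Distinguished W L u =
    Dominated W u ⊎
    (∀ v → v ≢ u → Dominated W v ⊎ (∃ λ l → l ∈ L × Separates l u v))

  DetectionPair : Subset n → Subset n → Set
  DetectionPair W L = ∀ u → Distinguished W L u

  -- A leg attached to x with leaf y: a path x = p 0, p 1, ..., p (k+1) = y
  -- (at least one edge, vertices pairwise distinct), whose inner vertices
  -- p 1 .. p k have degree 2 and whose endpoint y has degree 1.
  record LegPath (x y : Vertex) : Set where
    field
      k      : ℕ
      p      : Fin (suc (suc k)) → Vertex
      inj    : Injective _≡_ _≡_ p
      start  : p zero ≡ x
      end    : p (fromℕ (suc k)) ≡ y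
      edges  : ∀ (i : Fin (suc k)) → Adj (p (inject₁ i)) (p (suc i))
      inner  : ∀ (j : Fin k) → deg (p (suc (inject₁ j))) ≡ 2
      leafDeg : deg y ≡ 1

  SpecialBranchingLeg : Vertex → Vertex → Set
  SpecialBranchingLeg x y = deg x ≥ 3 × LegPath x y

-- Number the leg x = q 0, q 1, …, q K = y. A vertex off the leg can reach y only through x,
-- so its distance to y is its distance to x plus K, whereas the leg vertex q i (i ≥ 1) is at
-- distance K − i < K from y. The lower bounds on walk lengths come from the potential that is
-- i at q i and 0 off the leg, which grows by at most one along an edge. Hence d(u, y)
-- determines d(u, x), and every pair separated by x is separated by y.

module Submission where

open import Defs
open import Data.Bool using (T)
open import Data.Bool.Properties using (T-≡)
open import Data.Empty using (⊥-elim)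
open import Data.Fin using (Fin; zero; suc; inject₁; fromℕ; fromℕ<; toℕ; _≟_)
open import Data.Fin.Properties using (any?; toℕ-inject₁; toℕ-fromℕ<; toℕ-injective; toℕ≤pred[n])
open import Data.Fin.Subset using (Subset; _∈_; _-_; _∪_; ⁅_⁆; ∣_∣)
open import Data.Fin.Subset.Properties using (x∈p⇒∣p-x∣<∣p∣; x∈p∧x≢y⇒x∈p-y; x∈p∪q⁺; x∈⁅x⁆)
open import Data.Nat using (ℕ; zero; suc; _+_; _∸_; _≤_; _<_; z≤n; s≤s; z<s)
open import Data.Nat.Properties hiding (_≟_)
open import Data.Product using (∃; ∃₂; _×_; _,_; proj₁)
open import Data.Sum using (_⊎_; inj₁; inj₂)
import Data.Sum as Sum
open import Data.Vec.Properties using (lookup∘tabulate; lookup⇒[]=)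
open import Function using (_∘_)
open import Function.Bundles using (_⇔_; mk⇔; Equivalence)
open import Function.Construct.Composition using (_⇔-∘_)
open import Function.Construct.Identity using (⇔-id)
open import Function.Construct.Symmetry using (⇔-sym)
open import Relation.Nullary using (¬_; Dec; yes; no)
open import Relation.Binary.PropositionalEquality

open Equivalence using (to)

private
  variable
    n : ℕ
    p : Subset n
    a b c : Fin n

x∈p⇒0<∣p∣ : a ∈ p → 0 < ∣ p ∣
x∈p⇒0<∣p∣ a∈p = ≤-trans (s≤s z≤n) (x∈p⇒∣p-x∣<∣p∣ a∈p)

two-members⇒2≤∣p∣ : a ∈ p → b ∈ p → a ≢ b → 2 ≤ ∣ p ∣
two-members⇒2≤∣p∣ a∈p b∈p a≢b =
  ≤-trans (s≤s (x∈p⇒0<∣p∣ (x∈p∧x≢y⇒x∈p-y b∈p (a≢b ∘ sym)))) (x∈p⇒∣p-x∣<∣p∣ a∈p)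

∣p∣≡1⇒≡ : ∣ p ∣ ≡ 1 → a ∈ p → c ∈ p → c ≡ a
∣p∣≡1⇒≡ {a = a} {c = c} ∣p∣≡1 a∈p c∈p with c ≟ a
... | yes c≡a = c≡a
... | no c≢a with subst (2 ≤_) ∣p∣≡1 (two-members⇒2≤∣p∣ c∈p a∈p c≢a)
...   | s≤s ()

∣p∣≡2⇒≡⊎≡ : ∣ p ∣ ≡ 2 → a ∈ p → b ∈ p → a ≢ b → c ∈ p → c ≡ a ⊎ c ≡ b
∣p∣≡2⇒≡⊎≡ {p = p} {a = a} {b = b} {c = c} ∣p∣≡2 a∈p b∈p a≢b c∈p with c ≟ a | c ≟ b
... | yes c≡a | _       = inj₁ c≡a
... | no _    | yes c≡b = inj₂ c≡b
... | no c≢a  | no c≢b with subst (∣ p - a ∣ <_) ∣p∣≡2 (x∈p⇒∣p-x∣<∣p∣ a∈p)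
...   | ∣p-a∣<2 = ⊥-elim (<⇒≱ ∣p-a∣<2 (two-members⇒2≤∣p∣ c∈p-a b∈p-a c≢b))
  where
  c∈p-a = x∈p∧x≢y⇒x∈p-y c∈p c≢a
  b∈p-a = x∈p∧x≢y⇒x∈p-y b∈p (a≢b ∘ sym)

clamp : (m : ℕ) → ℕ → Fin (suc m)
clamp zero    _       = zero
clamp (suc m) zero    = zero
clamp (suc m) (suc i) = suc (clamp m i)

toℕ-clamp : ∀ m {i} → i ≤ m → toℕ (clamp m i) ≡ i
toℕ-clamp zero    z≤n       = refl
toℕ-clamp (suc m) z≤n       = refl
toℕ-clamp (suc m) (s≤s i≤m) = cong suc (toℕ-clamp m i≤m)

clamp-suc : ∀ m {i} → i ≤ m → clamp (suc m) i ≡ inject₁ (clamp m i)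
clamp-suc m {i} i≤m = toℕ-injective (begin
  toℕ (clamp (suc m) i)     ≡⟨ toℕ-clamp (suc m) (m≤n⇒m≤1+n i≤m) ⟩
  i                         ≡⟨ toℕ-clamp m i≤m ⟨
  toℕ (clamp m i)           ≡⟨ toℕ-inject₁ (clamp m i) ⟨
  toℕ (inject₁ (clamp m i)) ∎)
  where open ≡-Reasoning

clamp-self : ∀ m → clamp m m ≡ fromℕ m
clamp-self zero    = refl
clamp-self (suc m) = cong suc (clamp-self m)

module Walks (G : Graph) where

  adj-sym : ∀ {u v} → Adj G u v → Adj G v u
  adj-sym {u} {v} = subst T (Graph.sym G u v)

  Adj⇒∈N : ∀ {v w} → Adj G v w → w ∈ N G v
  Adj⇒∈N {v} {w} vw = lookup⇒[]= w (N G v) (trans (lookup∘tabulate (Graph.adj G v) w) (to T-≡ vw))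

  _++ʷ_ : ∀ {u v w i j} → Walk G u v i → Walk G v w j → Walk G u w (i + j)
  here      ++ʷ vw = vw
  step e uv ++ʷ vw = step e (uv ++ʷ vw)

  IsDist-functional : ∀ {u v i j} → IsDist G u v i → IsDist G u v j → i ≡ j
  IsDist-functional (wi , mi) (wj , mj) =
    ≤-antisym (≮⇒≥ (λ j<i → mi _ j<i wj)) (≮⇒≥ (λ i<j → mj _ i<j wi))

  walk-length-bound : (h : Vertex G → ℕ) → (∀ {u v} → Adj G u v → h v ≤ suc (h u)) →
                      ∀ {u v m} → Walk G u v m → h v ≤ h u + m
  walk-length-bound h lip {u} here = m≤m+n (h u) 0
  walk-length-bound h lip {u} {v} (step {w = w} {k = m} e wv) = begin
    h v           ≤⟨ walk-length-bound h lip wv ⟩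
    h w + m       ≤⟨ +-monoˡ-≤ m (lip e) ⟩
    suc (h u) + m ≡⟨ +-suc (h u) m ⟨
    h u + suc m   ∎
    where open ≤-Reasoning

  walk-through-cut : ∀ {x} (S : Vertex G → Set) → (∀ {u w} → S u → u ≢ x → Adj G u w → S w) →
                     ∀ {u t m} → S u → ¬ S t → Walk G u t m →
                     ∃₂ λ i j → Walk G u x i × Walk G x t j × i + j ≡ m
  walk-through-cut S closed Su ¬St here = ⊥-elim (¬St Su)
  walk-through-cut {x} S closed {u} Su ¬St (step {k = m} e wt) with u ≟ x
  ... | yes refl = 0 , suc m , here , step e wt , refl
  ... | no u≢x with walk-through-cut S closed (closed Su u≢x e) ¬St wt
  ...   | i , j , wx , xt , i+j≡m = suc i , j , step e wx , xt , cong suc i+j≡m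

  IsDist-through-cut : ∀ {u x y K} → Walk G x y K →
                       (∀ {m} → Walk G u y m → ∃ λ i → Walk G u x i × i + K ≤ m) →
                       ∀ j → IsDist G u x j ⇔ IsDist G u y (j + K)
  IsDist-through-cut {u} {x} {y} {K} xy cut j = mk⇔ toY toX
    where
    toY : IsDist G u x j → IsDist G u y (j + K)
    toY (ux , min) = ux ++ʷ xy , λ m m<j+K uy →
      let (i , ux′ , i+K≤m) = cut uy in min i (+-cancelʳ-< K i j (<-≤-trans (s≤s i+K≤m) m<j+K)) ux′
    toX : IsDist G u y (j + K) → IsDist G u x j
    toX (uy , min) with cut uy
    ... | i , ux , i+K≤j+K =
      subst (Walk G u x) i≡j ux , λ m m<j ux′ → min (m + K) (+-monoˡ-< K m<j) (ux′ ++ʷ xy)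
      where
      i≡j : i ≡ j
      i≡j = ≤-antisym (+-cancelʳ-≤ K i j i+K≤j+K)
                      (≮⇒≥ (λ i<j → min (i + K) (+-monoˡ-< K i<j) (ux ++ʷ xy)))

module Leg (G : Graph) {x y : Vertex G} (P : LegPath G x y) where
  open Walks G
  open LegPath P using (k; inj; start; end; edges; inner; leafDeg) renaming (p to path)

  K : ℕ
  K = suc k

  -- q i = y for every i ≥ K.
  q : ℕ → Vertex G
  q i = path (clamp K i)

  q-zero : q 0 ≡ x
  q-zero = start

  q-last : q K ≡ y
  q-last = trans (cong path (clamp-self K)) end

  q-injective : ∀ {i j} → i ≤ K → j ≤ K → q i ≡ q j → i ≡ j
  q-injective {i} {j} i≤K j≤K qi≡qj =
    trans (sym (toℕ-clamp K i≤K)) (trans (cong toℕ (inj qi≡qj)) (toℕ-clamp K j≤K))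

  q-adjacent : ∀ {i} → i ≤ k → Adj G (q i) (q (suc i))
  q-adjacent {i} i≤k =
    subst (λ f → Adj G (path f) (q (suc i))) (sym (clamp-suc k i≤k)) (edges (clamp k i))

  q-deg-inner : ∀ {i} → i < k → deg G (q (suc i)) ≡ 2
  q-deg-inner {i} i<k = subst (λ f → deg G (path (suc f)) ≡ 2) (sym clamp≡) (inner (fromℕ< i<k))
    where
    clamp≡ : clamp k i ≡ inject₁ (fromℕ< i<k)
    clamp≡ = toℕ-injective (trans (toℕ-clamp k (<⇒≤ i<k))
                                  (sym (trans (toℕ-inject₁ (fromℕ< i<k)) (toℕ-fromℕ< i<k))))

  leg-neighbour : ∀ {i w} → i ≤ k → Adj G (q (suc i)) w → w ≡ q i ⊎ (i < k × w ≡ q (suc (suc i)))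
  leg-neighbour {i} i≤k e with m≤n⇒m<n∨m≡n i≤k
  ... | inj₁ i<k = Sum.map₂ (i<k ,_)
    (∣p∣≡2⇒≡⊎≡ (q-deg-inner i<k) (Adj⇒∈N (adj-sym (q-adjacent i≤k))) (Adj⇒∈N (q-adjacent i<k))
               (<⇒≢ (m<n+m i z<s) ∘ q-injective (m≤n⇒m≤1+n i≤k) (s≤s i<k)) (Adj⇒∈N e))
  ... | inj₂ refl = inj₁ (∣p∣≡1⇒≡ leafDeg (Adj⇒∈N y-qk) (Adj⇒∈N (subst (λ v → Adj G v _) q-last e)))
    where
    y-qk : Adj G y (q k)
    y-qk = subst (λ v → Adj G v (q k)) q-last (adj-sym (q-adjacent ≤-refl))

  OnLeg : Vertex G → Set
  OnLeg w = ∃ λ (i : Fin K) → w ≡ q (suc (toℕ i))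

  onLeg? : ∀ w → Dec (OnLeg w)
  onLeg? w = any? (λ i → w ≟ q (suc (toℕ i)))

  q-onLeg : ∀ {i} → i ≤ k → OnLeg (q (suc i))
  q-onLeg i≤k = fromℕ< (s≤s i≤k) , cong (q ∘ suc) (sym (toℕ-fromℕ< (s≤s i≤k)))

  q-offLeg : ∀ {i} → i ≤ K → ¬ OnLeg (q i) → i ≡ 0
  q-offLeg {zero}  _         _   = refl
  q-offLeg {suc i} (s≤s i≤k) off = ⊥-elim (off (q-onLeg i≤k))

  height : Vertex G → ℕ
  height w with onLeg? w
  ... | yes (i , _) = suc (toℕ i)
  ... | no _        = 0

  height-q : ∀ {i} → i ≤ K → height (q i) ≡ i
  height-q {i} i≤K with onLeg? (q i)
  ... | yes (j , qi≡qj) = sym (q-injective i≤K (s≤s (toℕ≤pred[n] j)) qi≡qj)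
  ... | no off          = sym (q-offLeg i≤K off)

  height-adjacent : ∀ {u v} → Adj G u v → height v ≤ suc (height u)
  height-adjacent {u} {v} e with onLeg? v
  ... | no _ = z≤n
  ... | yes (i , refl) with leg-neighbour (toℕ≤pred[n] i) (adj-sym e)
  ...   | inj₁ refl       = ≤-reflexive (cong suc (sym (height-q (m≤n⇒m≤1+n (toℕ≤pred[n] i)))))
  ...   | inj₂ (i<k , refl) rewrite height-q (s≤s i<k) = m≤n+m _ 2

  walk-to-leaf : ∀ d i → d + i ≡ K → Walk G (q i) y d
  walk-to-leaf zero    i i≡K = subst (λ v → Walk G (q i) v 0) (trans (cong q i≡K) q-last) here
  walk-to-leaf (suc d) i d+i≡K = step (q-adjacent (subst (i ≤_) (suc-injective d+i≡K) (m≤n+m i d)))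
                                      (walk-to-leaf d (suc i) (trans (+-suc d i) d+i≡K))

  walk-to-leaf-length : ∀ {i m} → i ≤ K → Walk G (q i) y m → K ≤ i + m
  walk-to-leaf-length {i} i≤K w = begin
    K                ≡⟨ height-q ≤-refl ⟨
    height (q K)     ≡⟨ cong height q-last ⟩
    height y         ≤⟨ walk-length-bound height height-adjacent w ⟩
    height (q i) + _ ≡⟨ cong (_+ _) (height-q i≤K) ⟩
    i + _            ∎
    where open ≤-Reasoning

  IsDist-to-leaf : ∀ {i} → i ≤ K → IsDist G (q i) y (K ∸ i)
  IsDist-to-leaf {i} i≤K = walk-to-leaf (K ∸ i) i (m∸n+n≡m i≤K) ,
    λ m m<K∸i w → <⇒≱ m<K∸i (m≤n+o⇒m∸n≤o K i (walk-to-leaf-length i≤K w))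

  offLeg-closed : ∀ {u w} → ¬ OnLeg u → u ≢ x → Adj G u w → ¬ OnLeg w
  offLeg-closed off u≢x e (i , refl) with leg-neighbour (toℕ≤pred[n] i) (adj-sym e)
  ... | inj₁ refl = u≢x (trans (cong q (q-offLeg (m≤n⇒m≤1+n (toℕ≤pred[n] i)) off)) q-zero)
  ... | inj₂ (i<k , refl) = off (q-onLeg i<k)

  y-onLeg : OnLeg y
  y-onLeg = subst OnLeg q-last (q-onLeg ≤-refl)

  offLeg-walk-to-leaf : ∀ {u m} → ¬ OnLeg u → Walk G u y m → ∃ λ i → Walk G u x i × i + K ≤ m
  offLeg-walk-to-leaf off w with walk-through-cut (¬_ ∘ OnLeg) offLeg-closed off (λ off-y → off-y y-onLeg) w
  ... | i , j , ux , xy , i+j≡m = i , ux , subst (_ ≤_) i+j≡m (+-monoʳ-≤ i K≤j)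
    where
    K≤j : K ≤ j
    K≤j = walk-to-leaf-length z≤n (subst (λ v → Walk G v y j) (sym q-zero) xy)

  base-to-leaf : Walk G x y K
  base-to-leaf = subst (λ v → Walk G v y K) q-zero (walk-to-leaf K 0 (+-identityʳ K))

  offLeg-IsDist : ∀ {u} → ¬ OnLeg u → ∀ j → IsDist G u x j ⇔ IsDist G u y (j + K)
  offLeg-IsDist off = IsDist-through-cut base-to-leaf (offLeg-walk-to-leaf off)

  onLeg-offLeg-separated : ∀ {u v} → OnLeg u → ¬ OnLeg v → ¬ SameDist G y u v
  onLeg-offLeg-separated {v = v} (i , refl) off same =
    let (j , _ , j+K≤K∸i) = offLeg-walk-to-leaf off (proj₁ v-to-leaf)
    in <⇒≱ (s≤s (m∸n≤m k (toℕ i))) (≤-trans (m≤n+m K j) j+K≤K∸i)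
    where
    v-to-leaf : IsDist G v y (K ∸ suc (toℕ i))
    v-to-leaf = to (same _) (IsDist-to-leaf (s≤s (toℕ≤pred[n] i)))

  onLeg-determined : ∀ {u v} → OnLeg u → OnLeg v → SameDist G y u v → u ≡ v
  onLeg-determined (i , refl) (j , refl) same = cong q (∸-cancelˡ-≡ i≤K j≤K K∸i≡K∸j)
    where
    i≤K = s≤s (toℕ≤pred[n] i)
    j≤K = s≤s (toℕ≤pred[n] j)
    K∸i≡K∸j = IsDist-functional (to (same _) (IsDist-to-leaf i≤K)) (IsDist-to-leaf j≤K)

  leaf-equidistant⇒base-equidistant : ∀ {u v} → SameDist G y u v → SameDist G x u v
  leaf-equidistant⇒base-equidistant {u} {v} same with onLeg? u | onLeg? v
  ... | yes on-u | yes on-v rewrite onLeg-determined on-u on-v same = λ _ → ⇔-id _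
  ... | yes on-u | no off-v = ⊥-elim (onLeg-offLeg-separated on-u off-v same)
  ... | no off-u | yes on-v = ⊥-elim (onLeg-offLeg-separated on-v off-u (⇔-sym ∘ same))
  ... | no off-u | no off-v =
    λ j → ⇔-sym (offLeg-IsDist off-v j) ⇔-∘ (same (j + K) ⇔-∘ offLeg-IsDist off-u j)

module _ (G : Graph) {x y : Vertex G} {W L : Subset (Graph.n G)} where

  separator-exchange : (∀ {u v} → SameDist G y u v → SameDist G x u v) →
                       ∀ {u v} → ∃ (λ l → l ∈ L × Separates G l u v) →
                       ∃ (λ l → l ∈ (L - x) ∪ ⁅ y ⁆ × Separates G l u v)
  separator-exchange y⇒x (l , l∈L , sep) with l ≟ x
  ... | yes refl = y , x∈p∪q⁺ (inj₂ (x∈⁅x⁆ y)) , sep ∘ y⇒x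
  ... | no l≢x   = l , x∈p∪q⁺ (inj₁ (x∈p∧x≢y⇒x∈p-y l∈L l≢x)) , sep

  detectionPair-exchange : (∀ {u v} → SameDist G y u v → SameDist G x u v) →
                           DetectionPair G W L → DetectionPair G W ((L - x) ∪ ⁅ y ⁆)
  detectionPair-exchange y⇒x detect u =
    Sum.map₂ (λ distinguish v v≢u → Sum.map₂ (separator-exchange y⇒x) (distinguish v v≢u)) (detect u)

lemma5 : (G : Graph) (x y : Vertex G) (W L : Subset (Graph.n G)) →
         SpecialBranchingLeg G x y →
         DetectionPair G W L →
         x ∈ L →
         DetectionPair G W ((L - x) ∪ ⁅ y ⁆)
lemma5 G x y W L (_ , leg) detect _ =
  detectionPair-exchange G (Leg.leaf-equidistant⇒base-equidistant G leg) detect
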